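{- Let $k\ge2$ and let $H$ be the $k$-uniform simplex on vertex set $[k+1]$ (edges: all $k$-subsets of $[k+1]$). For a derangement $\sigma$ of $[k+1]$ define $D_\sigma=\bigcup_{i=1}^{k+1}S_{[k+1]\setminus\{\sigma(i)\}}(i)$. Then $R(H)=\{D_\sigma:\sigma\in\mathfrak D_{k+1}\}$, where $\mathfrak D_{k+1}$ is the set of derangements of $[k+1]$.
   Context: For a $k$-set $e$ and $u\in e$, $S_e(u)$ is the digraph with arcs $uv$, $v\in e\setminus\{u\}$; unions of digraphs add arc multiplicities. A rooting of $H$ is a sequence $R=((e_1,v_1),\dots,(e_m,v_m))$ with $\{e_1,\dots,e_m\}=E(H)$ as multisets, $v_i\in e_i$, $v_1\le\dots\le v_m$; $D_R=\bigcup_iS_{e_i}(v_i)$. $R$ is an Euler rooting if $D_R$ is Eulerian (weakly connected, in-degree equal to out-degree at every vertex). $R(H)$ denotes the multiset of rooted digraphs $D_R$ over all Euler rootings $R$ of $H$. A derangement is a permutation without fixed points. -}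

module Defs where

open import Data.Nat using (ℕ; zero; suc; _+_; _<_)
open import Data.Bool using (Bool; true; false; if_then_else_; _∧_; not)
open import Data.Fin using (Fin; _≟_)
import Data.Fin as F
open import Data.Fin.Subset using (Subset; _∈_; ∁; ⁅_⁆; ∣_∣)
open import Data.Fin.Subset.Properties using (_∈?_)
open import Data.Fin.Permutation using (Permutation′; _⟨$⟩ʳ_)
import Data.Fin.Permutation as Perm
open import Data.List using (List; []; _∷_; map; _++_; filter; allFin; foldr)
import Data.List as L
open import Data.List.Relation.Unary.All using (All)
open import Data.Nat.ListAction using (sum)
open import Data.List.Relation.Unary.Linked using (Linked)
open import Data.List.Relation.Binary.Permutation.Propositional using (_↭_)
open import Data.Vec using ([]; _∷_)
open import Data.Product using (Σ; _×_; _,_; proj₁; proj₂)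
open import Relation.Nullary using (¬_; ⌊_⌋)
open import Relation.Binary.PropositionalEquality using (_≡_; _≢_)

-- Digraphs on vertex set Fin n, as arc-multiplicity functions.

Digraph : ℕ → Set
Digraph n = Fin n → Fin n → ℕ

∅D : ∀ {n} → Digraph n
∅D x y = 0

_∪D_ : ∀ {n} → Digraph n → Digraph n → Digraph n
(D ∪D D′) x y = D x y + D′ x y

_≐_ : ∀ {n} → Digraph n → Digraph n → Set
D ≐ D′ = ∀ x y → D x y ≡ D′ x y

S : ∀ {n} → Subset n → Fin n → Digraph n
S e u x y = if ⌊ x ≟ u ⌋ ∧ ⌊ y ∈? e ⌋ ∧ not ⌊ y ≟ u ⌋ then 1 else 0

ΣV : ∀ {n} → (Fin n → ℕ) → ℕ
ΣV {n} f = sum (map f (allFin n))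

outdeg indeg : ∀ {n} → Digraph n → Fin n → ℕ
outdeg D v = ΣV (λ w → D v w)
indeg  D v = ΣV (λ u → D u v)

data WConn {n} (D : Digraph n) : Fin n → Fin n → Set where
  here : ∀ {x} → WConn D x x
  fwd  : ∀ {x z y} → 0 < D x z → WConn D z y → WConn D x y
  bwd  : ∀ {x z y} → 0 < D z x → WConn D z y → WConn D x y

WeaklyConnected : ∀ {n} → Digraph n → Set
WeaklyConnected {n} D = ∀ (x y : Fin n) → WConn D x y

Eulerian : ∀ {n} → Digraph n → Set
Eulerian D = WeaklyConnected D × (∀ v → indeg D v ≡ outdeg D v)

-- Hypergraphs on vertex set Fin n: a multiset (list) of edges.

Hypergraph : ℕ → Set
Hypergraph n = List (Subset n)

allSubsets : ∀ n → List (Subset n)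
allSubsets zero    = [] ∷ []
allSubsets (suc n) = map (true ∷_) (allSubsets n) ++ map (false ∷_) (allSubsets n)

simplex : ∀ k → Hypergraph (suc k)
simplex k = filter (λ e → ∣ e ∣ ≟ℕ k) (allSubsets (suc k))
  where open Data.Nat using () renaming (_≟_ to _≟ℕ_)

RootSeq : ℕ → Set
RootSeq n = List (Subset n × Fin n)

D[_] : ∀ {n} → RootSeq n → Digraph n
D[ R ] = foldr (λ p D → S (proj₁ p) (proj₂ p) ∪D D) ∅D R

IsRooting : ∀ {n} → Hypergraph n → RootSeq n → Set
IsRooting H R =
  (map proj₁ R ↭ H)
  × All (λ p → proj₂ p ∈ proj₁ p) R
  × Linked F._≤_ (map proj₂ R)

IsEulerRooting : ∀ {n} → Hypergraph n → RootSeq n → Set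
IsEulerRooting H R = IsRooting H R × Eulerian D[ R ]

EulerRooting : ∀ {n} → Hypergraph n → Set
EulerRooting {n} H = Σ (RootSeq n) (IsEulerRooting H)

Derangement : ℕ → Set
Derangement n = Σ (Permutation′ n) λ σ → ∀ i → σ ⟨$⟩ʳ i ≢ i

Dσ : ∀ {n} → Permutation′ n → Digraph n
Dσ {n} σ = foldr (λ i D → S (∁ ⁅ σ ⟨$⟩ʳ i ⁆) i ∪D D) ∅D (allFin n)

-- Equality of two multisets of digraphs, each given as an indexed family
-- over an index type with an equivalence ("same underlying object"):
-- a bijection of the index sets (respecting the equivalences) that
-- matches up the digraphs.

record SameMultiset {n} (I : Set) (_≈I_ : I → I → Set) (f : I → Digraph n)
                        (J : Set) (_≈J_ : J → J → Set) (g : J → Digraph n) : Set where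
  field
    to      : I → J
    from    : J → I
    to-cong   : ∀ {i i′} → i ≈I i′ → to i ≈J to i′
    from-cong : ∀ {j j′} → j ≈J j′ → from j ≈I from j′
    from-to : ∀ i → from (to i) ≈I i
    to-from : ∀ j → to (from j) ≈J j
    preserves : ∀ i → g (to i) ≐ f i

-- R(H): Euler rootings (two are the same iff equal as sequences) ↦ D_R
-- {D_σ}: derangements (same iff equal as permutations) ↦ D_σ
_≈R_ : ∀ {n} {H : Hypergraph n} → EulerRooting H → EulerRooting H → Set
R ≈R R′ = proj₁ R ≡ proj₁ R′

_≈σ_ : ∀ {n} → Derangement n → Derangement n → Set
σ ≈σ τ = proj₁ σ Perm.≈ proj₁ τ

-- Let r(v) be the number of edges rooted at v. The edges of the simplex are the k-sets
-- [k+1] ∖ {j}, one for each j, so every vertex lies in k of them; hence in D_R the out-degree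
-- of v is r(v)(k − 1) and its in-degree is k − r(v). Thus D_R is balanced iff every r(v) = 1,
-- and then the sorted rooting is ((e_i, i))_i with e_i = [k+1] ∖ {σ(i)}: σ is a bijection since
-- the e_i are the distinct edges, it has no fixed point since i ∈ e_i, and D_R = D_σ.
-- Conversely the rooting of a derangement is balanced, and for k ≥ 2 it is weakly connected.
module Submission where

open import Defs
open import Data.Bool using (Bool; true; false; if_then_else_; _∧_; not)
open import Data.Fin using (Fin; zero; suc; _≟_)
import Data.Fin as Fin
open import Data.Fin.Permutation using (Permutation′; _⟨$⟩ʳ_; _⟨$⟩ˡ_; inverseʳ; permutation)
open import Data.Fin.Properties using (≤-totalOrder)
open import Data.Fin.Subset using (Subset; _∈_; ∁; ⁅_⁆; ∣_∣; inside; outside; ⊥; ⊤)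
open import Data.Fin.Subset.Properties
  using (_∈?_; x∈∁p⇒x∉p; x∉p⇒x∈∁p; x∉⁅y⁆⇒x≢y; x≢y⇒x∉⁅y⁆;
         ∣∁p∣≡n∸∣p∣; ∣⁅x⁆∣≡1; ∣⊥∣≡0; ∣p∣≡n⇒p≡⊤)
open import Data.List using (List; []; _∷_; map; allFin; tabulate)
open import Data.List.Membership.Propositional using () renaming (_∈_ to _∈ₗ_)
open import Data.List.Membership.Propositional.Properties
  using (∈-allFin; ∈-map⁺; ∈-map⁻; ∈-++⁺ˡ; ∈-++⁺ʳ; ∈-filter⁺; ∈-filter⁻)
open import Data.List.Membership.Propositional.Properties.WithK using (unique∧set⇒bag)
open import Data.List.Properties using (map-tabulate; map-∘; map-id; map-cong; map-cong-local; foldr-map)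
open import Data.List.Relation.Binary.BagAndSetEquality using (∼bag⇒↭)
open import Data.List.Relation.Binary.Permutation.Propositional using (_↭_; ↭-sym; ↭-trans; ↭⇒↭ₛ)
import Data.List.Relation.Binary.Permutation.Propositional.Properties as ↭
import Data.List.Relation.Binary.Permutation.Setoid.Properties as ↭ₛ
open import Data.List.Relation.Binary.Pointwise using (Pointwise-≡⇒≡)
open import Data.List.Relation.Unary.All using (All; []; _∷_)
import Data.List.Relation.Unary.All as All
import Data.List.Relation.Unary.All.Properties as All
open import Data.List.Relation.Unary.AllPairs using ([]; _∷_)
open import Data.List.Relation.Unary.AllPairs.Properties using (tabulate⁺-<)
open import Data.List.Relation.Unary.Any using (here; there)
open import Data.List.Relation.Unary.Linked using (Linked)
open import Data.List.Relation.Unary.Linked.Properties using (AllPairs⇒Linked)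
open import Data.List.Relation.Unary.Sorted.TotalOrder.Properties using (↗↭↗⇒≋)
open import Data.List.Relation.Unary.Unique.Propositional using (Unique)
import Data.List.Relation.Unary.Unique.Propositional.Properties as Unique
open import Data.Nat using (ℕ; zero; suc; _+_; _*_; _∸_; _≤_; _<_; z≤n; s≤s) renaming (_≟_ to _≟ℕ_)
open import Data.Nat.ListAction using (sum)
open import Data.Nat.ListAction.Properties using (sum-↭)
open import Data.Nat.Properties
  using (+-*-semiring; +-commutativeSemigroup; +-identityʳ; *-identityˡ; *-suc; *-distribʳ-+; *-cancelʳ-≡;
         suc-injective; ≤-trans; ≤-reflexive; m≤m+n; m≤n+m; m+n≤o⇒n≤o; <⇒≤)
open import Data.Product using (_×_; _,_; proj₁; proj₂; ∃)
open import Data.Vec using ([]; _∷_)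
open import Data.Vec.Properties using (∷-injectiveʳ)
open import Function using (id; _∘_)
open import Function.Bundles using (_⇔_; mk⇔; Injection)
open import Function.Properties.Inverse using (↔⇒↣)
open import Relation.Binary.PropositionalEquality
open import Relation.Nullary using (¬_; ⌊_⌋; yes; no; contradiction)
open import Relation.Nullary.Decidable using (Dec; isYes≗does; does-⇔)
open ≡-Reasoning

open import Algebra.Properties.Semiring.Sum +-*-semiring
  using (∑-distrib-+; sum-cong-≗; *-distribˡ-sum; *-distribʳ-sum; sum-replicate-zero)
  renaming (sum to ∑)
open import Algebra.Properties.CommutativeSemigroup +-commutativeSemigroup using (interchange)

ind : Bool → ℕ
ind b = if b then 1 else 0

ind-∧ : ∀ a b → ind (a ∧ b) ≡ ind a * ind b
ind-∧ false b = refl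
ind-∧ true  b = sym (+-identityʳ (ind b))

sum-tabulate : ∀ {n} (f : Fin n → ℕ) → sum (tabulate f) ≡ ∑ f
sum-tabulate {zero}  f = refl
sum-tabulate {suc n} f = cong (f zero +_) (sum-tabulate (λ i → f (suc i)))

ΣV≡∑ : ∀ {n} (f : Fin n → ℕ) → ΣV f ≡ ∑ f
ΣV≡∑ f = trans (cong sum (map-tabulate id f)) (sum-tabulate f)

-- ⌊_⌋ (isYes) is stuck on the Dec.map′ in the suc clauses of _≟_ and _∈?_, whereas does computes.
⌊suc≟suc⌋ : ∀ {n} (x u : Fin n) → ⌊ suc x ≟ suc u ⌋ ≡ ⌊ x ≟ u ⌋
⌊suc≟suc⌋ x u = trans (isYes≗does (suc x ≟ suc u)) (sym (isYes≗does (x ≟ u)))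

⌊suc∈?∷⌋ : ∀ {n} (x : Fin n) s e → ⌊ suc x ∈? s ∷ e ⌋ ≡ ⌊ x ∈? e ⌋
⌊suc∈?∷⌋ x s e = trans (isYes≗does (suc x ∈? s ∷ e)) (sym (isYes≗does (x ∈? e)))

⌊⌋-⇔ : ∀ {A B : Set} → A ⇔ B → (a? : Dec A) (b? : Dec B) → ⌊ a? ⌋ ≡ ⌊ b? ⌋
⌊⌋-⇔ A⇔B a? b? = trans (isYes≗does a?) (trans (does-⇔ A⇔B a? b?) (sym (isYes≗does b?)))

∑-δ : ∀ {n} (u : Fin n) → ∑ (λ x → ind ⌊ x ≟ u ⌋) ≡ 1
∑-δ {suc n} zero    = cong suc (sum-replicate-zero n)
∑-δ {suc n} (suc u) = trans (sum-cong-≗ (λ x → cong ind (⌊suc≟suc⌋ x u))) (∑-δ u)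

∑-∈-tail : ∀ {n} s (e : Subset n) → ∑ (λ x → ind ⌊ suc x ∈? s ∷ e ⌋) ≡ ∑ (λ x → ind ⌊ x ∈? e ⌋)
∑-∈-tail s e = sum-cong-≗ (λ x → cong ind (⌊suc∈?∷⌋ x s e))

∑-∈ : ∀ {n} (e : Subset n) → ∑ (λ x → ind ⌊ x ∈? e ⌋) ≡ ∣ e ∣
∑-∈ []            = refl
∑-∈ (inside ∷ e)  = cong suc (trans (∑-∈-tail inside e) (∑-∈ e))
∑-∈ (outside ∷ e) = trans (∑-∈-tail outside e) (∑-∈ e)

ΣV-distrib-+ : ∀ {n} (f g : Fin n → ℕ) → ΣV (λ x → f x + g x) ≡ ΣV f + ΣV g
ΣV-distrib-+ f g = begin
  ΣV (λ x → f x + g x) ≡⟨ ΣV≡∑ (λ x → f x + g x) ⟩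
  ∑ (λ x → f x + g x)  ≡⟨ ∑-distrib-+ f g ⟩
  ∑ f + ∑ g            ≡⟨ sym (cong₂ _+_ (ΣV≡∑ f) (ΣV≡∑ g)) ⟩
  ΣV f + ΣV g          ∎

ΣV-zero : ∀ n → ΣV {n} (λ _ → 0) ≡ 0
ΣV-zero n = trans (ΣV≡∑ {n} (λ _ → 0)) (sum-replicate-zero n)

outdeg-∪D : ∀ {n} (D D′ : Digraph n) v → outdeg (D ∪D D′) v ≡ outdeg D v + outdeg D′ v
outdeg-∪D D D′ v = ΣV-distrib-+ (D v) (D′ v)

indeg-∪D : ∀ {n} (D D′ : Digraph n) v → indeg (D ∪D D′) v ≡ indeg D v + indeg D′ v
indeg-∪D D D′ v = ΣV-distrib-+ (λ u → D u v) (λ u → D′ u v)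

[_∈_∖_] : ∀ {n} → Fin n → Subset n → Fin n → Bool
[ y ∈ e ∖ u ] = ⌊ y ∈? e ⌋ ∧ not ⌊ y ≟ u ⌋

S≡ind*ind : ∀ {n} (e : Subset n) u x y → S e u x y ≡ ind ⌊ x ≟ u ⌋ * ind [ y ∈ e ∖ u ]
S≡ind*ind e u x y = ind-∧ ⌊ x ≟ u ⌋ [ y ∈ e ∖ u ]

outdeg-S : ∀ {n} (e : Subset n) u v → outdeg (S e u) v ≡ ind ⌊ v ≟ u ⌋ * ∑ (λ y → ind [ y ∈ e ∖ u ])
outdeg-S e u v = begin
  outdeg (S e u) v
    ≡⟨ ΣV≡∑ (S e u v) ⟩
  ∑ (S e u v)
    ≡⟨ sum-cong-≗ (S≡ind*ind e u v) ⟩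
  ∑ (λ y → ind ⌊ v ≟ u ⌋ * ind [ y ∈ e ∖ u ])
    ≡⟨ *-distribˡ-sum (ind ⌊ v ≟ u ⌋) (λ y → ind [ y ∈ e ∖ u ]) ⟨
  ind ⌊ v ≟ u ⌋ * ∑ (λ y → ind [ y ∈ e ∖ u ])
    ∎

indeg-S : ∀ {n} (e : Subset n) u v → indeg (S e u) v ≡ ind [ v ∈ e ∖ u ]
indeg-S e u v = begin
  indeg (S e u) v
    ≡⟨ ΣV≡∑ (λ x → S e u x v) ⟩
  ∑ (λ x → S e u x v)
    ≡⟨ sum-cong-≗ (λ x → S≡ind*ind e u x v) ⟩
  ∑ (λ x → ind ⌊ x ≟ u ⌋ * ind [ v ∈ e ∖ u ])
    ≡⟨ *-distribʳ-sum (ind [ v ∈ e ∖ u ]) (λ x → ind ⌊ x ≟ u ⌋) ⟨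
  ∑ (λ x → ind ⌊ x ≟ u ⌋) * ind [ v ∈ e ∖ u ]
    ≡⟨ cong (_* ind [ v ∈ e ∖ u ]) (∑-δ u) ⟩
  1 * ind [ v ∈ e ∖ u ]
    ≡⟨ *-identityˡ _ ⟩
  ind [ v ∈ e ∖ u ]
    ∎

ind-∈-split : ∀ {n} {e : Subset n} {u} → u ∈ e → ∀ y → ind ⌊ y ≟ u ⌋ + ind [ y ∈ e ∖ u ] ≡ ind ⌊ y ∈? e ⌋
ind-∈-split {e = e} {u} u∈e y with y ≟ u | y ∈? e
... | yes refl | yes _   = refl
... | yes refl | no y∉e  = contradiction u∈e y∉e
... | no _     | yes _   = refl
... | no _     | no _    = refl

suc-∑-∈∖≡∣∣ : ∀ {n} {e : Subset n} {u} → u ∈ e → suc (∑ (λ y → ind [ y ∈ e ∖ u ])) ≡ ∣ e ∣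
suc-∑-∈∖≡∣∣ {e = e} {u} u∈e = begin
  1 + ∑ (λ y → ind [ y ∈ e ∖ u ])
    ≡⟨ cong (_+ ∑ (λ y → ind [ y ∈ e ∖ u ])) (∑-δ u) ⟨
  ∑ (λ y → ind ⌊ y ≟ u ⌋) + ∑ (λ y → ind [ y ∈ e ∖ u ])
    ≡⟨ ∑-distrib-+ (λ y → ind ⌊ y ≟ u ⌋) (λ y → ind [ y ∈ e ∖ u ]) ⟨
  ∑ (λ y → ind ⌊ y ≟ u ⌋ + ind [ y ∈ e ∖ u ])
    ≡⟨ sum-cong-≗ (ind-∈-split u∈e) ⟩
  ∑ (λ y → ind ⌊ y ∈? e ⌋)
    ≡⟨ ∑-∈ e ⟩
  ∣ e ∣
    ∎

outdeg-S-of-size : ∀ {n m} {e : Subset n} {u} → u ∈ e → ∣ e ∣ ≡ suc m →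
                   ∀ v → outdeg (S e u) v ≡ ind ⌊ v ≟ u ⌋ * m
outdeg-S-of-size {e = e} {u} u∈e ∣e∣≡1+m v =
  trans (outdeg-S e u v) (cong (ind ⌊ v ≟ u ⌋ *_) (suc-injective (trans (suc-∑-∈∖≡∣∣ u∈e) ∣e∣≡1+m)))

indeg-S-rooted : ∀ {n} {e : Subset n} {u} → u ∈ e →
                 ∀ v → ind ⌊ v ≟ u ⌋ + indeg (S e u) v ≡ ind ⌊ v ∈? e ⌋
indeg-S-rooted {e = e} {u} u∈e v = trans (cong (ind ⌊ v ≟ u ⌋ +_) (indeg-S e u v)) (ind-∈-split u∈e v)

occurrences : ∀ {n} → Fin n → List (Fin n) → ℕ
occurrences v us = sum (map (λ u → ind ⌊ v ≟ u ⌋) us)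

rootCount : ∀ {n} → RootSeq n → Fin n → ℕ
rootCount R v = occurrences v (map proj₂ R)

vertexDegree : ∀ {n} → Hypergraph n → Fin n → ℕ
vertexDegree H v = sum (map (λ e → ind ⌊ v ∈? e ⌋) H)

RootInEdge : ∀ {n} → Subset n × Fin n → Set
RootInEdge (e , u) = u ∈ e

outdeg-D[] : ∀ {n m} {R : RootSeq n} → All RootInEdge R → All (λ (e , _) → ∣ e ∣ ≡ suc m) R →
             ∀ v → outdeg D[ R ] v ≡ rootCount R v * m
outdeg-D[] {n} [] [] v = ΣV-zero n
outdeg-D[] {m = m} {(e , u) ∷ R} (u∈e ∷ rooted) (∣e∣≡1+m ∷ uniform) v = begin
  outdeg (S e u ∪D D[ R ]) v            ≡⟨ outdeg-∪D (S e u) D[ R ] v ⟩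
  outdeg (S e u) v + outdeg D[ R ] v    ≡⟨ cong₂ _+_ (outdeg-S-of-size u∈e ∣e∣≡1+m v) (outdeg-D[] rooted uniform v) ⟩
  ind ⌊ v ≟ u ⌋ * m + rootCount R v * m ≡⟨ *-distribʳ-+ m (ind ⌊ v ≟ u ⌋) (rootCount R v) ⟨
  (ind ⌊ v ≟ u ⌋ + rootCount R v) * m   ∎

indeg-D[] : ∀ {n} {R : RootSeq n} → All RootInEdge R →
            ∀ v → rootCount R v + indeg D[ R ] v ≡ vertexDegree (map proj₁ R) v
indeg-D[] {n} [] v = ΣV-zero n
indeg-D[] {R = (e , u) ∷ R} (u∈e ∷ rooted) v = begin
  (ind ⌊ v ≟ u ⌋ + rootCount R v) + indeg (S e u ∪D D[ R ]) v
    ≡⟨ cong (ind ⌊ v ≟ u ⌋ + rootCount R v +_) (indeg-∪D (S e u) D[ R ] v) ⟩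
  (ind ⌊ v ≟ u ⌋ + rootCount R v) + (indeg (S e u) v + indeg D[ R ] v)
    ≡⟨ interchange (ind ⌊ v ≟ u ⌋) (rootCount R v) (indeg (S e u) v) (indeg D[ R ] v) ⟩
  (ind ⌊ v ≟ u ⌋ + indeg (S e u) v) + (rootCount R v + indeg D[ R ] v)
    ≡⟨ cong₂ _+_ (indeg-S-rooted u∈e v) (indeg-D[] rooted v) ⟩
  ind ⌊ v ∈? e ⌋ + vertexDegree (map proj₁ R) v
    ∎

Balanced : ∀ {n} → Digraph n → Set
Balanced D = ∀ v → indeg D v ≡ outdeg D v

module _ {n m} {R : RootSeq n} (rooted : All RootInEdge R) (uniform : All (λ (e , _) → ∣ e ∣ ≡ suc m) R)
         (regular : ∀ v → vertexDegree (map proj₁ R) v ≡ suc m) where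

  balanced⇒rootCount≡1 : Balanced D[ R ] → ∀ v → rootCount R v ≡ 1
  balanced⇒rootCount≡1 balanced v = *-cancelʳ-≡ (rootCount R v) 1 (suc m) (begin
    rootCount R v * suc m               ≡⟨ *-suc (rootCount R v) m ⟩
    rootCount R v + rootCount R v * m   ≡⟨ cong (rootCount R v +_) (outdeg-D[] rooted uniform v) ⟨
    rootCount R v + outdeg D[ R ] v     ≡⟨ cong (rootCount R v +_) (balanced v) ⟨
    rootCount R v + indeg D[ R ] v      ≡⟨ indeg-D[] rooted v ⟩
    vertexDegree (map proj₁ R) v        ≡⟨ regular v ⟩
    suc m                               ≡⟨ *-identityˡ (suc m) ⟨
    1 * suc m                           ∎)

  rootCount≡1⇒balanced : (∀ v → rootCount R v ≡ 1) → Balanced D[ R ]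
  rootCount≡1⇒balanced once v = begin
    indeg D[ R ] v       ≡⟨ suc-injective 1+indeg≡1+m ⟩
    m                    ≡⟨ *-identityˡ m ⟨
    1 * m                ≡⟨ cong (_* m) (once v) ⟨
    rootCount R v * m    ≡⟨ outdeg-D[] rooted uniform v ⟨
    outdeg D[ R ] v      ∎
    where
    1+indeg≡1+m : 1 + indeg D[ R ] v ≡ suc m
    1+indeg≡1+m = begin
      1 + indeg D[ R ] v              ≡⟨ cong (_+ indeg D[ R ] v) (once v) ⟨
      rootCount R v + indeg D[ R ] v  ≡⟨ indeg-D[] rooted v ⟩
      vertexDegree (map proj₁ R) v    ≡⟨ regular v ⟩
      suc m                           ∎

unique-same-elements⇒↭ : ∀ {A : Set} {xs ys : List A} → Unique xs → Unique ys →
                         (∀ {x} → x ∈ₗ xs → x ∈ₗ ys) → (∀ {x} → x ∈ₗ ys → x ∈ₗ xs) → xs ↭ ys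
unique-same-elements⇒↭ xs! ys! xs⊆ys ys⊆xs = ∼bag⇒↭ (unique∧set⇒bag xs! ys! (mk⇔ xs⊆ys ys⊆xs))

unique-map⇒injective : ∀ {A B : Set} (g : A → B) {xs} → Unique (map g xs) →
                       ∀ {i j} → i ∈ₗ xs → j ∈ₗ xs → g i ≡ g j → i ≡ j
unique-map⇒injective g (_  ∷ _)  (here refl) (here refl) _  = refl
unique-map⇒injective g (g≢ ∷ _)  (here refl) (there j∈) eq = contradiction eq (All.lookup g≢ (∈-map⁺ g j∈))
unique-map⇒injective g (g≢ ∷ _)  (there i∈) (here refl) eq = contradiction (sym eq) (All.lookup g≢ (∈-map⁺ g i∈))
unique-map⇒injective g (_  ∷ g!) (there i∈) (there j∈) eq = unique-map⇒injective g g! i∈ j∈ eq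

occurrences-pos⇒∈ : ∀ {n} {v : Fin n} us → 0 < occurrences v us → v ∈ₗ us
occurrences-pos⇒∈ {v = v} (u ∷ us) pos with v ≟ u
... | yes refl = here refl
... | no _     = there (occurrences-pos⇒∈ us pos)

∈⇒occurrences-pos : ∀ {n} {v : Fin n} {us} → v ∈ₗ us → 0 < occurrences v us
∈⇒occurrences-pos {v = v} (here refl) with v ≟ v
... | yes _   = s≤s z≤n
... | no v≢v  = contradiction refl v≢v
∈⇒occurrences-pos (there {x = u} v∈us) = ≤-trans (∈⇒occurrences-pos v∈us) (m≤n+m _ (ind ⌊ _ ≟ u ⌋))

occurrences≤1⇒Unique : ∀ {n} {us : List (Fin n)} → (∀ v → occurrences v us ≤ 1) → Unique us
occurrences≤1⇒Unique {us = []}     _          = []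
occurrences≤1⇒Unique {us = u ∷ us} atMostOnce =
  All.tabulate head-not-repeated ∷ occurrences≤1⇒Unique (λ v → m+n≤o⇒n≤o (ind ⌊ v ≟ u ⌋) (atMostOnce v))
  where
  head-not-repeated : ∀ {y} → y ∈ₗ us → u ≢ y
  head-not-repeated y∈us refl with u ≟ u | atMostOnce u
  ... | yes _   | s≤s occ≤0 = contradiction (≤-trans (∈⇒occurrences-pos y∈us) occ≤0) λ ()
  ... | no u≢u  | _         = u≢u refl

occurrences≡1⇒↭allFin : ∀ {n} {us : List (Fin n)} → (∀ v → occurrences v us ≡ 1) → us ↭ allFin n
occurrences≡1⇒↭allFin {n} {us} once =
  unique-same-elements⇒↭ (occurrences≤1⇒Unique (≤-reflexive ∘ once)) (Unique.allFin⁺ n)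
    (λ {v} _ → ∈-allFin v) (λ {v} _ → occurrences-pos⇒∈ us (≤-reflexive (sym (once v))))

occurrences-allFin : ∀ {n} (v : Fin n) → occurrences v (allFin n) ≡ 1
occurrences-allFin {n} v = begin
  occurrences v (allFin n)    ≡⟨ ΣV≡∑ (λ u → ind ⌊ v ≟ u ⌋) ⟩
  ∑ (λ u → ind ⌊ v ≟ u ⌋)     ≡⟨ sum-cong-≗ (λ u → cong ind (⌊⌋-⇔ (mk⇔ sym sym) (v ≟ u) (u ≟ v))) ⟩
  ∑ (λ u → ind ⌊ u ≟ v ⌋)     ≡⟨ ∑-δ v ⟩
  1                           ∎

allFin-sorted : ∀ n → Linked Fin._≤_ (allFin n)
allFin-sorted n = AllPairs⇒Linked (tabulate⁺-< <⇒≤)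

sorted-↭allFin⇒≡allFin : ∀ {n} {us : List (Fin n)} → Linked Fin._≤_ us → us ↭ allFin n → us ≡ allFin n
sorted-↭allFin⇒≡allFin {n} us↗ us↭ = Pointwise-≡⇒≡ (↗↭↗⇒≋ (≤-totalOrder n) us↗ (allFin-sorted n) (↭⇒↭ₛ us↭))

map-permutation-allFin↭ : ∀ {n} (π : Permutation′ n) → map (π ⟨$⟩ʳ_) (allFin n) ↭ allFin n
map-permutation-allFin↭ {n} π = unique-same-elements⇒↭
  (Unique.map⁺ (Injection.injective (↔⇒↣ π)) (Unique.allFin⁺ n)) (Unique.allFin⁺ n)
  (λ {j} _ → ∈-allFin j)
  (λ {j} _ → subst (_∈ₗ map (π ⟨$⟩ʳ_) (allFin n)) (inverseʳ π) (∈-map⁺ (π ⟨$⟩ʳ_) (∈-allFin (π ⟨$⟩ˡ j))))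

∈∁⁅⁆⇒≢ : ∀ {n} {x y : Fin n} → x ∈ ∁ ⁅ y ⁆ → x ≢ y
∈∁⁅⁆⇒≢ = x∉⁅y⁆⇒x≢y ∘ x∈∁p⇒x∉p

≢⇒∈∁⁅⁆ : ∀ {n} {x y : Fin n} → x ≢ y → x ∈ ∁ ⁅ y ⁆
≢⇒∈∁⁅⁆ = x∉p⇒x∈∁p ∘ x≢y⇒x∉⁅y⁆

∈∁⁅⁆-swap : ∀ {n} {x y : Fin n} → x ∈ ∁ ⁅ y ⁆ ⇔ y ∈ ∁ ⁅ x ⁆
∈∁⁅⁆-swap = mk⇔ swap swap
  where
  swap : ∀ {x y} → x ∈ ∁ ⁅ y ⁆ → y ∈ ∁ ⁅ x ⁆
  swap = ≢⇒∈∁⁅⁆ ∘ ≢-sym ∘ ∈∁⁅⁆⇒≢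

∣∁⁅⁆∣ : ∀ {n} (j : Fin (suc n)) → ∣ ∁ ⁅ j ⁆ ∣ ≡ n
∣∁⁅⁆∣ {n} j = trans (∣∁p∣≡n∸∣p∣ ⁅ j ⁆) (cong (suc n ∸_) (∣⁅x⁆∣≡1 j))

-- Junk value: the last vertex if e = ⊤.
missingVertex : ∀ {n} → Subset (suc n) → Fin (suc n)
missingVertex          (outside ∷ _) = zero
missingVertex {zero}   (inside ∷ _)  = zero
missingVertex {suc n}  (inside ∷ e)  = suc (missingVertex e)

missingVertex-∁⁅⁆ : ∀ {n} (j : Fin (suc n)) → missingVertex (∁ ⁅ j ⁆) ≡ j
missingVertex-∁⁅⁆         zero    = refl
missingVertex-∁⁅⁆ {suc n} (suc j) = cong suc (missingVertex-∁⁅⁆ j)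

∁⁅⁆-injective : ∀ {n} {i j : Fin (suc n)} → ∁ ⁅ i ⁆ ≡ ∁ ⁅ j ⁆ → i ≡ j
∁⁅⁆-injective {i = i} {j} eq = trans (sym (missingVertex-∁⁅⁆ i)) (trans (cong missingVertex eq) (missingVertex-∁⁅⁆ j))

∁⁅missingVertex⁆ : ∀ {n} (e : Subset (suc n)) → ∣ e ∣ ≡ n → ∁ ⁅ missingVertex e ⁆ ≡ e
∁⁅missingVertex⁆ {n}     (outside ∷ e)  ∣e∣≡n = cong (outside ∷_) (trans ∁⊥≡⊤ (sym (∣p∣≡n⇒p≡⊤ ∣e∣≡n)))
  where
  ∁⊥≡⊤ : ∁ (⊥ {n}) ≡ ⊤
  ∁⊥≡⊤ = ∣p∣≡n⇒p≡⊤ (trans (∣∁p∣≡n∸∣p∣ (⊥ {n})) (cong (n ∸_) (∣⊥∣≡0 n)))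
∁⁅missingVertex⁆ {zero}  (inside ∷ [])  ()
∁⁅missingVertex⁆ {suc n} (inside ∷ e)   ∣e∣≡n = cong (inside ∷_) (∁⁅missingVertex⁆ e (suc-injective ∣e∣≡n))

allSubsets-complete : ∀ {n} (e : Subset n) → e ∈ₗ allSubsets n
allSubsets-complete []            = here refl
allSubsets-complete (inside ∷ e)  = ∈-++⁺ˡ (∈-map⁺ (inside ∷_) (allSubsets-complete e))
allSubsets-complete (outside ∷ e) = ∈-++⁺ʳ _ (∈-map⁺ (outside ∷_) (allSubsets-complete e))

allSubsets-unique : ∀ n → Unique (allSubsets n)
allSubsets-unique zero    = [] ∷ []
allSubsets-unique (suc n) = Unique.++⁺ (Unique.map⁺ ∷-injectiveʳ (allSubsets-unique n))
                                       (Unique.map⁺ ∷-injectiveʳ (allSubsets-unique n)) disjoint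
  where
  disjoint : ∀ {e} → ¬ (e ∈ₗ map (inside ∷_) (allSubsets n) × e ∈ₗ map (outside ∷_) (allSubsets n))
  disjoint (e∈ins , e∈outs) with ∈-map⁻ (inside ∷_) e∈ins | ∈-map⁻ (outside ∷_) e∈outs
  ... | _ , _ , refl | _ , _ , ()

cosingletons : ∀ n → List (Subset n)
cosingletons n = map (λ j → ∁ ⁅ j ⁆) (allFin n)

cosingletons-unique : ∀ n → Unique (cosingletons (suc n))
cosingletons-unique n = Unique.map⁺ ∁⁅⁆-injective (Unique.allFin⁺ (suc n))

simplex-edge-size : ∀ {k e} → e ∈ₗ simplex k → ∣ e ∣ ≡ k
simplex-edge-size {k} e∈H = proj₂ (∈-filter⁻ (λ e → ∣ e ∣ ≟ℕ k) {xs = allSubsets (suc k)} e∈H)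

simplex-edge≡∁⁅missingVertex⁆ : ∀ {k e} → e ∈ₗ simplex k → ∁ ⁅ missingVertex e ⁆ ≡ e
simplex-edge≡∁⁅missingVertex⁆ {e = e} e∈H = ∁⁅missingVertex⁆ e (simplex-edge-size e∈H)

simplex↭cosingletons : ∀ k → simplex k ↭ cosingletons (suc k)
simplex↭cosingletons k = unique-same-elements⇒↭
  (Unique.filter⁺ (λ e → ∣ e ∣ ≟ℕ k) (allSubsets-unique (suc k)))
  (cosingletons-unique k)
  simplex⊆ ⊆simplex
  where
  simplex⊆ : ∀ {e} → e ∈ₗ simplex k → e ∈ₗ cosingletons (suc k)
  simplex⊆ {e} e∈H = subst (_∈ₗ cosingletons (suc k)) (simplex-edge≡∁⁅missingVertex⁆ e∈H)
                            (∈-map⁺ (λ j → ∁ ⁅ j ⁆) (∈-allFin (missingVertex e)))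
  ⊆simplex : ∀ {e} → e ∈ₗ cosingletons (suc k) → e ∈ₗ simplex k
  ⊆simplex e∈C with ∈-map⁻ (λ j → ∁ ⁅ j ⁆) {xs = allFin (suc k)} e∈C
  ... | j , _ , refl = ∈-filter⁺ (λ e → ∣ e ∣ ≟ℕ k) (allSubsets-complete (∁ ⁅ j ⁆)) (∣∁⁅⁆∣ j)

vertexDegree-↭ : ∀ {n} {H H′ : Hypergraph n} → H ↭ H′ → ∀ v → vertexDegree H v ≡ vertexDegree H′ v
vertexDegree-↭ H↭H′ v = sum-↭ (↭.map⁺ (λ e → ind ⌊ v ∈? e ⌋) H↭H′)

vertexDegree-cosingletons : ∀ {n} (v : Fin (suc n)) → vertexDegree (cosingletons (suc n)) v ≡ n
vertexDegree-cosingletons {n} v = begin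
  vertexDegree (cosingletons (suc n)) v ≡⟨ cong sum (map-∘ (allFin (suc n))) ⟨
  ΣV (λ j → ind ⌊ v ∈? ∁ ⁅ j ⁆ ⌋)      ≡⟨ ΣV≡∑ (λ j → ind ⌊ v ∈? ∁ ⁅ j ⁆ ⌋) ⟩
  ∑ (λ j → ind ⌊ v ∈? ∁ ⁅ j ⁆ ⌋)       ≡⟨ sum-cong-≗ (λ j → cong ind (⌊⌋-⇔ ∈∁⁅⁆-swap (v ∈? ∁ ⁅ j ⁆) (j ∈? ∁ ⁅ v ⁆))) ⟩
  ∑ (λ j → ind ⌊ j ∈? ∁ ⁅ v ⁆ ⌋)       ≡⟨ ∑-∈ (∁ ⁅ v ⁆) ⟩
  ∣ ∁ ⁅ v ⁆ ∣                          ≡⟨ ∣∁⁅⁆∣ v ⟩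
  n                                    ∎

vertexDegree-simplex : ∀ k v → vertexDegree (simplex k) v ≡ k
vertexDegree-simplex k v = trans (vertexDegree-↭ (simplex↭cosingletons k) v) (vertexDegree-cosingletons v)

module _ {k} {R : RootSeq (suc k)} (edges↭ : map proj₁ R ↭ simplex k) where

  simplex-rooting-uniform : All (λ (e , _) → ∣ e ∣ ≡ k) R
  simplex-rooting-uniform = All.tabulate (λ p∈R → simplex-edge-size (↭.∈-resp-↭ edges↭ (∈-map⁺ proj₁ p∈R)))

  simplex-rooting-regular : ∀ v → vertexDegree (map proj₁ R) v ≡ k
  simplex-rooting-regular v = trans (vertexDegree-↭ edges↭ v) (vertexDegree-simplex k v)

rootingOf : ∀ {n} → (Fin n → Fin n) → RootSeq n
rootingOf {n} f = map (λ i → (∁ ⁅ f i ⁆ , i)) (allFin n)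

roots-rootingOf : ∀ {n} (f : Fin n → Fin n) → map proj₂ (rootingOf f) ≡ allFin n
roots-rootingOf {n} f = trans (sym (map-∘ (allFin n))) (map-id (allFin n))

edges-rootingOf : ∀ {n} (f : Fin n → Fin n) → map proj₁ (rootingOf f) ≡ map (λ i → ∁ ⁅ f i ⁆) (allFin n)
edges-rootingOf {n} f = sym (map-∘ (allFin n))

rootCount-rootingOf : ∀ {n} (f : Fin n → Fin n) v → rootCount (rootingOf f) v ≡ 1
rootCount-rootingOf f v = trans (cong (occurrences v) (roots-rootingOf f)) (occurrences-allFin v)

Dσ≡D[rootingOf] : ∀ {n} (σ : Permutation′ n) → Dσ σ ≡ D[ rootingOf (σ ⟨$⟩ʳ_) ]
Dσ≡D[rootingOf] {n} σ =
  sym (foldr-map (λ p D → S (proj₁ p) (proj₂ p) ∪D D) (λ i → (∁ ⁅ σ ⟨$⟩ʳ i ⁆ , i)) ∅D (allFin n))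

-- Junk value: ⊤ if i is not a root of R.
edgeAt : ∀ {n} → RootSeq n → Fin n → Subset n
edgeAt []            i = ⊤
edgeAt ((e , u) ∷ R) i = if ⌊ i ≟ u ⌋ then e else edgeAt R i

edgeAt-graph : ∀ {n} (g : Fin n → Subset n) {xs i} → i ∈ₗ xs → edgeAt (map (λ j → (g j , j)) xs) i ≡ g i
edgeAt-graph g {x ∷ xs} {i} i∈xs with i ≟ x | i∈xs
... | yes refl | _           = refl
... | no i≢x   | here i≡x    = contradiction i≡x i≢x
... | no _     | there i∈xs′ = edgeAt-graph g i∈xs′

rooting≡graph-of-edgeAt : ∀ {n} (R : RootSeq n) → Unique (map proj₂ R) →
                          R ≡ map (λ i → (edgeAt R i , i)) (map proj₂ R)
rooting≡graph-of-edgeAt []            _ = refl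
rooting≡graph-of-edgeAt ((e , u) ∷ R) (u∉R ∷ R!) =
  cong₂ _∷_ (cong (_, u) (sym at-root)) (trans (rooting≡graph-of-edgeAt R R!) (map-cong-local (All.map skip u∉R)))
  where
  at-root : edgeAt ((e , u) ∷ R) u ≡ e
  at-root with u ≟ u
  ... | yes _   = refl
  ... | no u≢u  = contradiction refl u≢u
  skip : ∀ {i} → u ≢ i → (edgeAt R i , i) ≡ (edgeAt ((e , u) ∷ R) i , i)
  skip {i} u≢i with i ≟ u
  ... | yes i≡u = contradiction (sym i≡u) u≢i
  ... | no _    = refl

missingAt : ∀ {n} → RootSeq (suc n) → Fin (suc n) → Fin (suc n)
missingAt R i = missingVertex (edgeAt R i)

missingAt-rootingOf : ∀ {n} (f : Fin (suc n) → Fin (suc n)) i → missingAt (rootingOf f) i ≡ f i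
missingAt-rootingOf f i = trans (cong missingVertex (edgeAt-graph (λ j → ∁ ⁅ f j ⁆) (∈-allFin i))) (missingVertex-∁⁅⁆ (f i))

rootsInEdges-rootingOf : ∀ {n} {f : Fin n → Fin n} → (∀ i → f i ≢ i) → All RootInEdge (rootingOf f)
rootsInEdges-rootingOf f-fpf = All.map⁺ (All.tabulate⁺ (λ i → ≢⇒∈∁⁅⁆ (≢-sym (f-fpf i))))

rootingOf-fixedPointFree : ∀ {n} {f : Fin n → Fin n} → All RootInEdge (rootingOf f) → ∀ i → f i ≢ i
rootingOf-fixedPointFree rooted i = ≢-sym (∈∁⁅⁆⇒≢ (All.lookup (All.map⁻ rooted) (∈-allFin i)))

permutation-edges↭simplex : ∀ {k} (π : Permutation′ (suc k)) → map proj₁ (rootingOf (π ⟨$⟩ʳ_)) ↭ simplex k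
permutation-edges↭simplex {k} π =
  subst (_↭ simplex k) (sym (trans (edges-rootingOf (π ⟨$⟩ʳ_)) (map-∘ (allFin (suc k)))))
        (↭-trans (↭.map⁺ (λ j → ∁ ⁅ j ⁆) (map-permutation-allFin↭ π)) (↭-sym (simplex↭cosingletons k)))

module _ {k} {f : Fin (suc k) → Fin (suc k)} (edges↭ : map proj₁ (rootingOf f) ↭ simplex k) where

  private
    ∁⁅f⁆↭cosingletons : map (λ i → ∁ ⁅ f i ⁆) (allFin (suc k)) ↭ cosingletons (suc k)
    ∁⁅f⁆↭cosingletons = subst (_↭ cosingletons (suc k)) (edges-rootingOf f) (↭-trans edges↭ (simplex↭cosingletons k))

  edges↭simplex⇒surjective : ∀ j → ∃ λ i → f i ≡ j
  edges↭simplex⇒surjective j with ∈-map⁻ (λ i → ∁ ⁅ f i ⁆) ∁⁅j⁆∈edges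
    where
    ∁⁅j⁆∈edges : ∁ ⁅ j ⁆ ∈ₗ map (λ i → ∁ ⁅ f i ⁆) (allFin (suc k))
    ∁⁅j⁆∈edges = ↭.∈-resp-↭ (↭-sym ∁⁅f⁆↭cosingletons) (∈-map⁺ (λ j → ∁ ⁅ j ⁆) (∈-allFin j))
  ... | i , _ , ∁⁅j⁆≡∁⁅fi⁆ = i , ∁⁅⁆-injective (sym ∁⁅j⁆≡∁⁅fi⁆)

  edges↭simplex⇒injective : ∀ {i i′} → f i ≡ f i′ → i ≡ i′
  edges↭simplex⇒injective {i} {i′} eq = unique-map⇒injective (λ i → ∁ ⁅ f i ⁆)
    (↭ₛ.Unique-resp-↭ (setoid _) (↭⇒↭ₛ (↭-sym ∁⁅f⁆↭cosingletons)) (cosingletons-unique k))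
    (∈-allFin i) (∈-allFin i′) (cong (λ j → ∁ ⁅ j ⁆) eq)

  edges↭simplex⇒permutation : Permutation′ (suc k)
  edges↭simplex⇒permutation = permutation f (proj₁ ∘ edges↭simplex⇒surjective) (proj₂ ∘ edges↭simplex⇒surjective)
    (λ i → edges↭simplex⇒injective (proj₂ (edges↭simplex⇒surjective (f i))))

S-≤-D[] : ∀ {n} {R : RootSeq n} {e u} → (e , u) ∈ₗ R → ∀ x y → S e u x y ≤ D[ R ] x y
S-≤-D[] (here refl) x y = m≤m+n _ _
S-≤-D[] {R = (e , u) ∷ _} (there e∈R) x y = ≤-trans (S-≤-D[] e∈R x y) (m≤n+m _ (S e u x y))

S-at-root : ∀ {n} {e : Subset n} {u y} → y ∈ e → y ≢ u → S e u u y ≡ 1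
S-at-root {e = e} {u} {y} y∈e y≢u with u ≟ u | y ∈? e | y ≟ u
... | no u≢u | _      | _       = contradiction refl u≢u
... | yes _  | no y∉e | _       = contradiction y∈e y∉e
... | yes _  | yes _  | yes y≡u = contradiction y≡u y≢u
... | yes _  | yes _  | no _    = refl

rootingOf-arc : ∀ {n} {f : Fin n → Fin n} {x y} → y ≢ x → y ≢ f x → 0 < D[ rootingOf f ] x y
rootingOf-arc {f = f} {x} {y} y≢x y≢fx = subst (_≤ D[ rootingOf f ] x y) (S-at-root (≢⇒∈∁⁅⁆ y≢fx) y≢x)
  (S-≤-D[] (∈-map⁺ (λ i → (∁ ⁅ f i ⁆ , i)) (∈-allFin x)) x y)

third-vertex : ∀ {m} (x y : Fin (3 + m)) → ∃ λ z → z ≢ x × z ≢ y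
third-vertex zero             zero             = suc zero , (λ ()) , (λ ())
third-vertex zero             (suc zero)       = suc (suc zero) , (λ ()) , (λ ())
third-vertex zero             (suc (suc _))    = suc zero , (λ ()) , (λ ())
third-vertex (suc zero)       zero             = suc (suc zero) , (λ ()) , (λ ())
third-vertex (suc zero)       (suc zero)       = zero , (λ ()) , (λ ())
third-vertex (suc zero)       (suc (suc _))    = zero , (λ ()) , (λ ())
third-vertex (suc (suc _))    zero             = suc zero , (λ ()) , (λ ())
third-vertex (suc (suc _))    (suc zero)       = zero , (λ ()) , (λ ())
third-vertex (suc (suc _))    (suc (suc _))    = zero , (λ ()) , (λ ())

-- x → y is an arc unless y = f x; if moreover x = f y, a third vertex z gives x → z → y.
rootingOf-weaklyConnected : ∀ {m} {f : Fin (3 + m) → Fin (3 + m)} → (∀ {i j} → f i ≡ f j → i ≡ j) →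
                            WeaklyConnected D[ rootingOf f ]
rootingOf-weaklyConnected {f = f} f-injective x y with y ≟ x | y ≟ f x | x ≟ f y
... | yes refl | _        | _        = here
... | no y≢x   | no y≢fx  | _        = fwd (rootingOf-arc y≢x y≢fx) here
... | no y≢x   | yes _    | no x≢fy  = bwd (rootingOf-arc (≢-sym y≢x) x≢fy) here
... | no _     | yes y≡fx | yes _    with third-vertex x y
...   | z , z≢x , z≢y =
  fwd (rootingOf-arc z≢x (λ z≡fx → z≢y (trans z≡fx (sym y≡fx))))
      (fwd (rootingOf-arc (≢-sym z≢y) (λ y≡fz → z≢x (f-injective (trans (sym y≡fz) y≡fx)))) here)

derangement-isEulerRooting : ∀ {m} (σ : Derangement (3 + m)) →
                             IsEulerRooting (simplex (2 + m)) (rootingOf (proj₁ σ ⟨$⟩ʳ_))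
derangement-isEulerRooting {m} (π , π-fpf) = (edges↭ , rooted , sorted) , connected , balanced
  where
  R : RootSeq (3 + m)
  R = rootingOf (π ⟨$⟩ʳ_)
  edges↭ : map proj₁ R ↭ simplex (2 + m)
  edges↭ = permutation-edges↭simplex π
  rooted : All RootInEdge R
  rooted = rootsInEdges-rootingOf π-fpf
  sorted : Linked Fin._≤_ (map proj₂ R)
  sorted = subst (Linked Fin._≤_) (sym (roots-rootingOf (π ⟨$⟩ʳ_))) (allFin-sorted (3 + m))
  connected : WeaklyConnected D[ R ]
  connected = rootingOf-weaklyConnected (Injection.injective (↔⇒↣ π))
  balanced : Balanced D[ R ]
  balanced = rootCount≡1⇒balanced rooted (simplex-rooting-uniform edges↭) (simplex-rooting-regular {R = R} edges↭)
                                  (rootCount-rootingOf (π ⟨$⟩ʳ_))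

module EulerRootingOfSimplex {m} {R : RootSeq (2 + m)} (isEuler : IsEulerRooting (simplex (suc m)) R) where

  private
    edges↭ : map proj₁ R ↭ simplex (suc m)
    edges↭ = proj₁ (proj₁ isEuler)
    rooted : All RootInEdge R
    rooted = proj₁ (proj₂ (proj₁ isEuler))
    sorted : Linked Fin._≤_ (map proj₂ R)
    sorted = proj₂ (proj₂ (proj₁ isEuler))
    balanced : Balanced D[ R ]
    balanced = proj₂ (proj₂ isEuler)

  rootCount≡1 : ∀ v → rootCount R v ≡ 1
  rootCount≡1 = balanced⇒rootCount≡1 rooted (simplex-rooting-uniform edges↭)
                                     (simplex-rooting-regular {R = R} edges↭) balanced

  roots≡allFin : map proj₂ R ≡ allFin (2 + m)
  roots≡allFin = sorted-↭allFin⇒≡allFin sorted (occurrences≡1⇒↭allFin rootCount≡1)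

  R≡graph-of-edgeAt : R ≡ map (λ i → (edgeAt R i , i)) (allFin (2 + m))
  R≡graph-of-edgeAt = trans (rooting≡graph-of-edgeAt R (subst Unique (sym roots≡allFin) (Unique.allFin⁺ (2 + m))))
                            (cong (map (λ i → (edgeAt R i , i))) roots≡allFin)

  edgeAt∈simplex : ∀ i → edgeAt R i ∈ₗ simplex (suc m)
  edgeAt∈simplex i = ↭.∈-resp-↭ edges↭ (∈-map⁺ proj₁ (subst ((edgeAt R i , i) ∈ₗ_) (sym R≡graph-of-edgeAt)
                                                             (∈-map⁺ (λ i → (edgeAt R i , i)) (∈-allFin i))))

  R≡rootingOf-missingAt : R ≡ rootingOf (missingAt R)
  R≡rootingOf-missingAt = trans R≡graph-of-edgeAt
    (map-cong (λ i → cong (_, i) (sym (simplex-edge≡∁⁅missingVertex⁆ (edgeAt∈simplex i)))) (allFin (2 + m)))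

  derangement : Derangement (2 + m)
  derangement =
    edges↭simplex⇒permutation (subst (λ R → map proj₁ R ↭ simplex (suc m)) R≡rootingOf-missingAt edges↭) ,
    rootingOf-fixedPointFree (subst (All RootInEdge) R≡rootingOf-missingAt rooted)

  Dσ≐D[R] : Dσ (proj₁ derangement) ≐ D[ R ]
  Dσ≐D[R] x y = cong (λ D → D x y)
    (trans (Dσ≡D[rootingOf] (proj₁ derangement)) (cong D[_] (sym R≡rootingOf-missingAt)))

lemma7 : (k : ℕ) → 2 ≤ k →
    SameMultiset {suc k}
      (EulerRooting (simplex k)) _≈R_ (λ R → D[ proj₁ R ])
      (Derangement (suc k)) _≈σ_ (λ σ → Dσ (proj₁ σ))
lemma7 (suc (suc m)) (s≤s (s≤s z≤n)) = record
  { to        = λ (_ , isEuler) → EulerRootingOfSimplex.derangement isEuler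
  ; from      = λ σ → rootingOf (proj₁ σ ⟨$⟩ʳ_) , derangement-isEulerRooting σ
  ; to-cong   = λ R≡R′ i → cong (λ R → missingAt R i) R≡R′
  ; from-cong = λ σ≈τ → map-cong (λ i → cong (λ j → (∁ ⁅ j ⁆ , i)) (σ≈τ i)) (allFin (3 + m))
  ; from-to   = λ (_ , isEuler) → sym (EulerRootingOfSimplex.R≡rootingOf-missingAt isEuler)
  ; to-from   = λ σ → missingAt-rootingOf (proj₁ σ ⟨$⟩ʳ_)
  ; preserves = λ (_ , isEuler) → EulerRootingOfSimplex.Dσ≐D[R] isEuler
  }
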